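{- For every $n \geq 1$, the number $L_n$ of labelled loop-threshold graphs on vertex set $[n]$ satisfies $$L_n = \sum_{k=0}^n (-1)^{n-k}\,S(n,k)\,k!\,2^k.$$
   Context: Graphs here are finite, may have loops, but have no multiple edges. A graph is loop-threshold if it belongs to the smallest family of such graphs that contains $K_1$ (a single unlooped vertex) and $K_1^{\rm loop}$ (a single vertex with a loop), and is closed under adding an isolated (unlooped) vertex and adding a looped dominating vertex (a new vertex with a loop, adjacent to all existing vertices). A labelled loop-threshold graph on $[n]$ is such a graph with vertex set $[n]$; distinct sets of edges and loops give distinct graphs. $S(n,k)$ is the Stirling number of the second kind, with $S(n,0)=0$ for $n\ge 1$. -}

module Defs where

open import Data.Nat using (ℕ; zero; suc; _+_; _*_; _∸_; _^_; _!)
open import Data.Integer as ℤ using (ℤ; +_)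
open import Data.Bool using (Bool; true; false)
open import Data.Fin using (Fin; punchIn)
open import Data.Vec using (Vec; lookup)
open import Data.Product using (∃; _×_)
open import Relation.Binary.PropositionalEquality using (_≡_; _≢_)

-- Adjacency relation on vertex set Fin n; A i i ≡ true means a loop at i.
Adj : ℕ → Set
Adj n = Fin n → Fin n → Bool

delete : ∀ {n} → Fin (suc n) → Adj (suc n) → Adj n
delete v A i j = A (punchIn v i) (punchIn v j)

Isolated : ∀ {n} → Adj n → Fin n → Set
Isolated A v = ∀ u → (A v u ≡ false) × (A u v ≡ false)

LoopedDominating : ∀ {n} → Adj n → Fin n → Set
LoopedDominating A v = ∀ u → (A v u ≡ true) × (A u v ≡ true)

-- Loop-threshold graphs, labelled: the (isomorphism-closed) family generated
-- from K₁ and K₁^loop by adding an isolated vertex / a looped dominating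
-- vertex.
data LoopThreshold : ∀ {n} → Adj n → Set where
  base : (A : Adj 1) → LoopThreshold A
  addIsolated : ∀ {n} (A : Adj (suc (suc n))) (v : Fin (suc (suc n))) →
    Isolated A v → LoopThreshold (delete v A) → LoopThreshold A
  addDominating : ∀ {n} (A : Adj (suc (suc n))) (v : Fin (suc (suc n))) →
    LoopedDominating A v → LoopThreshold (delete v A) → LoopThreshold A

Graph : ℕ → Set
Graph n = Vec (Vec Bool n) n

adj : ∀ {n} → Graph n → Adj n
adj G i j = lookup (lookup G i) j

Symmetric : ∀ {n} → Graph n → Set
Symmetric G = ∀ i j → adj G i j ≡ adj G j i

IsLoopThresholdGraph : ∀ {n} → Graph n → Set
IsLoopThresholdGraph G = Symmetric G × LoopThreshold (adj G)

S : ℕ → ℕ → ℕ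
S zero zero = 1
S zero (suc k) = 0
S (suc n) zero = 0
S (suc n) (suc k) = suc k * S n (suc k) + S n k

sgn : ℕ → ℤ
sgn zero = + 1
sgn (suc m) = ℤ.- sgn m

sumTo : ℕ → (ℕ → ℤ) → ℤ
sumTo zero f = f 0
sumTo (suc m) f = sumTo m f ℤ.+ f (suc m)

formula : ℕ → ℤ
formula n = sumTo n (λ k → sgn (n ∸ k) ℤ.* (+ (S n k * (k !) * 2 ^ k)))

-- A loop-threshold graph on [n] is described by a surjective level function
-- F : [n] → {0,…,k−1} together with the type t of level 0: the types of
-- consecutive levels alternate, and two vertices (or a vertex and itself) are
-- adjacent iff the higher of their two levels has type "dominating".  A vertex
-- on the top level is isolated or dominating, so such graphs are
-- loop-threshold; conversely an isolated or looped dominating vertex added to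
-- a levelled graph goes on the top level or on a new level above it.  The
-- levels can be read off the graph, so graphs and codes (k, t, F) are in
-- bijection and L_n = 2 Σ_k S(n,k) k!.  The alternating formula equals this
-- because Σ_k (−1)^(n−k) C(k,j) S(n,k) k! = S(n,j) j! + S(n,j+1) (j+1)!,
-- which gives the formula after summing over j with Σ_j C(k,j) = 2^k.

module Submission where

open import Defs
open import Data.Nat as ℕ using (ℕ; zero; suc; pred; _!; _^_; _≤_; _<_; _≥_; z≤n; s≤s; _⊔_)
import Data.Nat.Properties as ℕ
open import Data.Nat.Combinatorics using (_C_; nC1≡n; nCk+nC[k+1]≡[n+1]C[k+1])
import Data.Nat.Tactic.RingSolver as ℕSolver
open import Data.Integer as ℤ using (ℤ; +_; _+_; _*_; -_; _-_)
import Data.Integer.Properties as ℤ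
open import Data.Integer.Tactic.RingSolver using (solve-∀)
open import Data.Bool as Bool using (Bool; true; false; not)
open import Data.Bool.Properties using (¬-not; not-¬; not-injective)
open import Data.Fin as Fin using (Fin; zero; suc; punchIn; punchOut; toℕ; fromℕ<)
import Data.Fin.Properties as Fin
open import Data.Vec as Vec using (Vec; []; _∷_; lookup; tabulate)
import Data.Vec.Properties as Vec
open import Data.Vec.Functional using (insertAt)
open import Data.Vec.Functional.Properties using (insertAt-lookup; insertAt-punchIn)
open import Data.Vec.Relation.Binary.Pointwise.Extensional using (ext; Pointwise-≡⇒≡)
open import Data.List as List using (List; []; _∷_; [_]; _++_; map; length; allFin; cartesianProductWith)
import Data.List.Properties as List
open import Data.List.Extrema.Nat using (argmax; f[xs]≤f[argmax])
open import Data.List.Membership.Propositional using (_∈_)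
open import Data.List.Membership.Propositional.Properties
open import Data.List.Relation.Unary.Any using (here)
open import Data.List.Relation.Unary.All as All using (All; []; _∷_)
import Data.List.Relation.Unary.All.Properties as All
open import Data.List.Relation.Unary.AllPairs using ([]; _∷_)
open import Data.List.Relation.Unary.Unique.Propositional using (Unique)
import Data.List.Relation.Unary.Unique.Propositional.Properties as Unique
open import Data.Product using (∃; _×_; _,_; proj₁; proj₂)
open import Data.Sum using (_⊎_; inj₁; inj₂)
open import Function using (_∘_)
open import Function.Bundles using (_⇔_; mk⇔)
open import Relation.Nullary using (¬_; Dec; yes; no; contradiction)
open import Relation.Binary.PropositionalEquality hiding ([_])
open ≡-Reasoning

sumTo-cong : ∀ B {f g : ℕ → ℤ} → (∀ k → k ≤ B → f k ≡ g k) → sumTo B f ≡ sumTo B g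
sumTo-cong zero    f≗g = f≗g 0 z≤n
sumTo-cong (suc B) f≗g =
  cong₂ _+_ (sumTo-cong B (λ k k≤B → f≗g k (ℕ.m≤n⇒m≤1+n k≤B))) (f≗g (suc B) ℕ.≤-refl)

sumTo-distrib-+ : ∀ B (f g : ℕ → ℤ) → sumTo B (λ k → f k + g k) ≡ sumTo B f + sumTo B g
sumTo-distrib-+ zero    f g = refl
sumTo-distrib-+ (suc B) f g = begin
  sumTo B (λ k → f k + g k) + (f (suc B) + g (suc B))
    ≡⟨ cong (_+ (f (suc B) + g (suc B))) (sumTo-distrib-+ B f g) ⟩
  (sumTo B f + sumTo B g) + (f (suc B) + g (suc B))
    ≡⟨ shuffle (sumTo B f) (sumTo B g) (f (suc B)) (g (suc B)) ⟩
  sumTo B f + f (suc B) + (sumTo B g + g (suc B)) ∎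
  where
  shuffle : ∀ a b c d → (a + b) + (c + d) ≡ (a + c) + (b + d)
  shuffle = solve-∀

sumTo-distribˡ-* : ∀ B c (f : ℕ → ℤ) → sumTo B (λ k → c * f k) ≡ c * sumTo B f
sumTo-distribˡ-* zero    c f = refl
sumTo-distribˡ-* (suc B) c f =
  trans (cong (_+ c * f (suc B)) (sumTo-distribˡ-* B c f)) (sym (ℤ.*-distribˡ-+ c (sumTo B f) (f (suc B))))

sumTo-distribʳ-* : ∀ B c (f : ℕ → ℤ) → sumTo B (λ k → f k * c) ≡ sumTo B f * c
sumTo-distribʳ-* zero    c f = refl
sumTo-distribʳ-* (suc B) c f =
  trans (cong (_+ f (suc B) * c) (sumTo-distribʳ-* B c f)) (sym (ℤ.*-distribʳ-+ c (sumTo B f) (f (suc B))))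

sumTo-comm : ∀ A B (f : ℕ → ℕ → ℤ) →
             sumTo A (λ i → sumTo B (f i)) ≡ sumTo B (λ j → sumTo A (λ i → f i j))
sumTo-comm zero    B f = refl
sumTo-comm (suc A) B f = begin
  sumTo A (λ i → sumTo B (f i)) + sumTo B (f (suc A))
    ≡⟨ cong (_+ sumTo B (f (suc A))) (sumTo-comm A B f) ⟩
  sumTo B (λ j → sumTo A (λ i → f i j)) + sumTo B (f (suc A))
    ≡⟨ sumTo-distrib-+ B _ _ ⟨
  sumTo B (λ j → sumTo (suc A) (λ i → f i j)) ∎

sumTo-suc : ∀ B (f : ℕ → ℤ) → sumTo (suc B) f ≡ f 0 + sumTo B (λ k → f (suc k))
sumTo-suc zero    f = refl
sumTo-suc (suc B) f = trans (cong (_+ f (suc (suc B))) (sumTo-suc B f)) (ℤ.+-assoc (f 0) _ _)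

sumTo-vanishing-last : ∀ B (f : ℕ → ℤ) → f (suc B) ≡ + 0 → sumTo (suc B) f ≡ sumTo B f
sumTo-vanishing-last B f f[1+B]≡0 = trans (cong (λ x → sumTo B f + x) f[1+B]≡0) (ℤ.+-identityʳ _)

sumTo-vanishing-tail : ∀ B (f : ℕ → ℤ) → (∀ k → f (suc k) ≡ + 0) → sumTo B f ≡ f 0
sumTo-vanishing-tail zero    f tail≡0 = refl
sumTo-vanishing-tail (suc B) f tail≡0 = trans (sumTo-vanishing-last B f (tail≡0 B)) (sumTo-vanishing-tail B f tail≡0)

-- The alternating sum

sgn-+-suc : ∀ m k → sgn (m ℕ.+ suc k) ≡ - sgn (m ℕ.+ k)
sgn-+-suc m k = cong sgn (ℕ.+-suc m k)

sgn-∸ : ∀ {n k} → k ≤ n → sgn (n ℕ.∸ k) ≡ sgn (n ℕ.+ k)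
sgn-∸ {n} z≤n = cong sgn (sym (ℕ.+-identityʳ n))
sgn-∸ {suc n} {suc k} (s≤s k≤n) = begin
  sgn (n ℕ.∸ k)        ≡⟨ sgn-∸ k≤n ⟩
  sgn (n ℕ.+ k)        ≡⟨ ℤ.neg-involutive _ ⟨
  - - sgn (n ℕ.+ k)    ≡⟨ cong -_ (sgn-+-suc n k) ⟨
  - sgn (n ℕ.+ suc k)  ∎

surjCount : ℕ → ℕ → ℕ
surjCount n k = S n k ℕ.* k !

surjCount-suc : ∀ n k → surjCount (suc n) k ≡ k ℕ.* (surjCount n k ℕ.+ surjCount n (pred k))
surjCount-suc n zero    = refl
surjCount-suc n (suc k) = ring (suc k) (S n (suc k)) (S n k) (k !)
  where
  ring : ∀ a s₁ s₀ f → (a ℕ.* s₁ ℕ.+ s₀) ℕ.* (a ℕ.* f) ≡ a ℕ.* (s₁ ℕ.* (a ℕ.* f) ℕ.+ s₀ ℕ.* f)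
  ring = ℕSolver.solve-∀

S-vanish : ∀ {n k} → n < k → S n k ≡ 0
S-vanish {zero}  {suc k} _ = refl
S-vanish {suc n} {suc k} (s≤s n<k)
  rewrite S-vanish n<k | S-vanish (ℕ.m<n⇒m<1+n n<k) = trans (ℕ.+-identityʳ _) (ℕ.*-zeroʳ k)

surjCount-vanish : ∀ {n k} → n < k → surjCount n k ≡ 0
surjCount-vanish {n} {k} n<k = cong (ℕ._* k !) (S-vanish n<k)

C-absorption : ∀ n k → suc k ℕ.* (suc n C suc k) ≡ suc n ℕ.* (n C k)
C-absorption zero    zero    = refl
C-absorption zero    (suc k) = ℕ.*-zeroʳ (suc (suc k))
C-absorption (suc n) zero    = trans (ℕ.*-identityˡ _) (trans (nC1≡n (suc (suc n))) (sym (ℕ.*-identityʳ _)))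
C-absorption (suc n) (suc k) = begin
  suc (suc k) ℕ.* q'
    ≡⟨ cong (suc (suc k) ℕ.*_) (nCk+nC[k+1]≡[n+1]C[k+1] (suc n) (suc k)) ⟨
  suc (suc k) ℕ.* (p ℕ.+ q)
    ≡⟨ expand k p q ⟩
  p ℕ.+ suc k ℕ.* p ℕ.+ suc (suc k) ℕ.* q
    ≡⟨ cong₂ (λ x y → p ℕ.+ x ℕ.+ y) (C-absorption n k) (C-absorption n (suc k)) ⟩
  p ℕ.+ suc n ℕ.* (n C k) ℕ.+ suc n ℕ.* (n C suc k)
    ≡⟨ factor p n (n C k) (n C suc k) ⟩
  p ℕ.+ suc n ℕ.* (n C k ℕ.+ n C suc k)
    ≡⟨ cong (λ x → p ℕ.+ suc n ℕ.* x) (nCk+nC[k+1]≡[n+1]C[k+1] n k) ⟩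
  suc (suc n) ℕ.* p ∎
  where
  p = suc n C suc k
  q = suc n C suc (suc k)
  q' = suc (suc n) C suc (suc k)
  expand : ∀ k p q → suc (suc k) ℕ.* (p ℕ.+ q) ≡ p ℕ.+ suc k ℕ.* p ℕ.+ suc (suc k) ℕ.* q
  expand = ℕSolver.solve-∀
  factor : ∀ p n r s → p ℕ.+ suc n ℕ.* r ℕ.+ suc n ℕ.* s ≡ p ℕ.+ suc n ℕ.* (r ℕ.+ s)
  factor = ℕSolver.solve-∀

C-weighted-step : ∀ i j →
  suc i ℕ.* (suc i C j) ≡ i ℕ.* (i C j) ℕ.+ (suc j ℕ.* (i C j) ℕ.+ j ℕ.* (i C pred j))
C-weighted-step i zero    = ring i
  where
  ring : ∀ i → suc i ℕ.* 1 ≡ i ℕ.* 1 ℕ.+ (1 ℕ.* 1 ℕ.+ 0)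
  ring = ℕSolver.solve-∀
C-weighted-step i (suc j) = begin
  suc i ℕ.* (suc i C suc j)
    ≡⟨ cong (suc i ℕ.*_) (nCk+nC[k+1]≡[n+1]C[k+1] i j) ⟨
  suc i ℕ.* (i C j ℕ.+ i C suc j)
    ≡⟨ ℕ.*-distribˡ-+ (suc i) (i C j) (i C suc j) ⟩
  suc i ℕ.* (i C j) ℕ.+ suc i ℕ.* (i C suc j)
    ≡⟨ cong (ℕ._+ suc i ℕ.* (i C suc j)) (C-absorption i j) ⟨
  suc j ℕ.* (suc i C suc j) ℕ.+ suc i ℕ.* (i C suc j)
    ≡⟨ cong (λ x → suc j ℕ.* x ℕ.+ suc i ℕ.* (i C suc j)) (nCk+nC[k+1]≡[n+1]C[k+1] i j) ⟨
  suc j ℕ.* (i C j ℕ.+ i C suc j) ℕ.+ suc i ℕ.* (i C suc j)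
    ≡⟨ regroup i j (i C j) (i C suc j) ⟩
  i ℕ.* (i C suc j) ℕ.+ (suc (suc j) ℕ.* (i C suc j) ℕ.+ suc j ℕ.* (i C j)) ∎
  where
  regroup : ∀ i j a b → suc j ℕ.* (a ℕ.+ b) ℕ.+ suc i ℕ.* b ≡ i ℕ.* b ℕ.+ (suc (suc j) ℕ.* b ℕ.+ suc j ℕ.* a)
  regroup = ℕSolver.solve-∀

C-row-sum : ∀ {k} B → k ≤ B → sumTo B (λ j → + (k C j)) ≡ + (2 ^ k)
C-row-sum {zero}  B _ = sumTo-vanishing-tail B _ (λ _ → refl)
C-row-sum {suc k} (suc B) (s≤s k≤B) = begin
  sumTo (suc B) (λ j → + (suc k C j))
    ≡⟨ sumTo-suc B _ ⟩
  + 1 + sumTo B (λ j → + (suc k C suc j))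
    ≡⟨ cong (λ x → + 1 + x) (sumTo-cong B (λ j _ → pascal j)) ⟩
  + 1 + sumTo B (λ j → + (k C j) + + (k C suc j))
    ≡⟨ cong (λ x → + 1 + x) (sumTo-distrib-+ B _ _) ⟩
  + 1 + (sumTo B (λ j → + (k C j)) + sumTo B (λ j → + (k C suc j)))
    ≡⟨ regroup (+ 1) (sumTo B (λ j → + (k C j))) (sumTo B (λ j → + (k C suc j))) ⟩
  sumTo B (λ j → + (k C j)) + (+ 1 + sumTo B (λ j → + (k C suc j)))
    ≡⟨ cong (λ x → sumTo B (λ j → + (k C j)) + x) (sumTo-suc B _) ⟨
  sumTo B (λ j → + (k C j)) + sumTo (suc B) (λ j → + (k C j))
    ≡⟨ cong₂ _+_ (C-row-sum B k≤B) (C-row-sum (suc B) (ℕ.m≤n⇒m≤1+n k≤B)) ⟩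
  + (2 ^ k) + + (2 ^ k)
    ≡⟨ ℤ.pos-+ (2 ^ k) (2 ^ k) ⟨
  + (2 ^ k ℕ.+ 2 ^ k)
    ≡⟨ cong (λ x → + (2 ^ k ℕ.+ x)) (ℕ.+-identityʳ (2 ^ k)) ⟨
  + (2 ^ suc k) ∎
  where
  pascal : ∀ j → + (suc k C suc j) ≡ + (k C j) + + (k C suc j)
  pascal j = trans (cong +_ (sym (nCk+nC[k+1]≡[n+1]C[k+1] k j))) (ℤ.pos-+ (k C j) (k C suc j))
  regroup : ∀ a b c → a + (b + c) ≡ b + (a + c)
  regroup = solve-∀

signedSurjSum : ℕ → ℕ → (ℕ → ℤ) → ℤ
signedSurjSum B n c = sumTo B (λ k → sgn (n ℕ.+ k) * c k * + surjCount n k)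

signedSurjSum-linear : ∀ B n a b (c d : ℕ → ℤ) →
  signedSurjSum B n (λ k → a * c k + b * d k) ≡ a * signedSurjSum B n c + b * signedSurjSum B n d
signedSurjSum-linear B n a b c d = begin
  signedSurjSum B n (λ k → a * c k + b * d k)
    ≡⟨ sumTo-cong B (λ k _ → distrib a b (sgn (n ℕ.+ k)) (c k) (d k) (+ surjCount n k)) ⟩
  sumTo B (λ k → a * (sgn (n ℕ.+ k) * c k * + surjCount n k) + b * (sgn (n ℕ.+ k) * d k * + surjCount n k))
    ≡⟨ sumTo-distrib-+ B _ _ ⟩
  sumTo B (λ k → a * (sgn (n ℕ.+ k) * c k * + surjCount n k))
    + sumTo B (λ k → b * (sgn (n ℕ.+ k) * d k * + surjCount n k))
    ≡⟨ cong₂ _+_ (sumTo-distribˡ-* B a _) (sumTo-distribˡ-* B b _) ⟩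
  a * signedSurjSum B n c + b * signedSurjSum B n d ∎
  where
  distrib : ∀ a b s x y t → s * (a * x + b * y) * t ≡ a * (s * x * t) + b * (s * y * t)
  distrib = solve-∀

-- The recurrence surjCount (n+1) k = k (surjCount n k + surjCount n (k−1)), moved onto
-- the coefficients.
signedSurjSum-suc : ∀ {B n} → n < B → ∀ c →
  signedSurjSum B (suc n) c ≡ signedSurjSum B n (λ i → + suc i * c (suc i) - + i * c i)
signedSurjSum-suc {suc B} {n} (s≤s n≤B) c = begin
  signedSurjSum (suc B) (suc n) c
    ≡⟨ sumTo-suc B _ ⟩
  sgn (suc n ℕ.+ 0) * c 0 * + 0 + sumTo B (λ i → sgn (suc n ℕ.+ suc i) * c (suc i) * + surjCount (suc n) (suc i))
    ≡⟨ cong₂ _+_ (ℤ.*-zeroʳ (sgn (suc n ℕ.+ 0) * c 0)) (sumTo-cong B (λ i _ → split i)) ⟩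
  + 0 + sumTo B (λ i → up i + down (suc i))
    ≡⟨ trans (ℤ.+-identityˡ _) (sumTo-distrib-+ B up (λ i → down (suc i))) ⟩
  sumTo B up + sumTo B (λ i → down (suc i))
    ≡⟨ cong₂ _+_ (sumTo-vanishing-last B up up-top) down-shift ⟨
  sumTo (suc B) up + sumTo (suc B) down
    ≡⟨ sumTo-distrib-+ (suc B) up down ⟨
  sumTo (suc B) (λ i → up i + down i)
    ≡⟨ sumTo-cong (suc B) (λ i _ → merge (sgn (n ℕ.+ i)) (+ suc i * c (suc i)) (+ i * c i) (+ surjCount n i)) ⟩
  signedSurjSum (suc B) n (λ i → + suc i * c (suc i) - + i * c i) ∎
  where
  up down : ℕ → ℤ
  up i = sgn (n ℕ.+ i) * (+ suc i * c (suc i)) * + surjCount n i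
  down i = - (sgn (n ℕ.+ i) * (+ i * c i) * + surjCount n i)

  down-shift : sumTo (suc B) down ≡ sumTo B (λ i → down (suc i))
  down-shift = trans (sumTo-suc B down)
    (trans (cong (_+ sumTo B (λ i → down (suc i))) (vanish (sgn (n ℕ.+ 0)) (c 0) (+ surjCount n 0))) (ℤ.+-identityˡ _))
    where
    vanish : ∀ s x t → - (s * (+ 0 * x) * t) ≡ + 0
    vanish = solve-∀

  up-top : up (suc B) ≡ + 0
  up-top = trans (cong (λ x → coefficient * + x) (surjCount-vanish (s≤s n≤B))) (ℤ.*-zeroʳ coefficient)
    where coefficient = sgn (n ℕ.+ suc B) * (+ suc (suc B) * c (suc (suc B)))

  split : ∀ i → sgn (suc n ℕ.+ suc i) * c (suc i) * + surjCount (suc n) (suc i) ≡ up i + down (suc i)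
  split i = begin
    - sgn (n ℕ.+ suc i) * c (suc i) * + surjCount (suc n) (suc i)
      ≡⟨ cong (λ x → - sgn (n ℕ.+ suc i) * c (suc i) * + x) (surjCount-suc n (suc i)) ⟩
    - sgn (n ℕ.+ suc i) * c (suc i) * + (suc i ℕ.* (surjCount n (suc i) ℕ.+ surjCount n i))
      ≡⟨ cong (λ x → - sgn (n ℕ.+ suc i) * c (suc i) * x)
              (trans (ℤ.pos-* (suc i) _) (cong (+ suc i *_) (ℤ.pos-+ (surjCount n (suc i)) _))) ⟩
    - sgn (n ℕ.+ suc i) * c (suc i) * (+ suc i * (+ surjCount n (suc i) + + surjCount n i))
      ≡⟨ sign-flip _ (sgn (n ℕ.+ i)) (c (suc i)) (+ suc i) (+ surjCount n (suc i)) (+ surjCount n i) (sgn-+-suc n i) ⟩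
    up i + down (suc i) ∎
    where
    sign-flip : ∀ σ s x k t₁ t₀ → σ ≡ - s → - σ * x * (k * (t₁ + t₀)) ≡ s * (k * x) * t₀ + - (σ * (k * x) * t₁)
    sign-flip σ s x k t₁ t₀ refl = ring s x k t₁ t₀
      where
      ring : ∀ s x k t₁ t₀ → - - s * x * (k * (t₁ + t₀)) ≡ s * (k * x) * t₀ + - (- s * (k * x) * t₁)
      ring = solve-∀

  merge : ∀ s a b t → s * a * t + - (s * b * t) ≡ s * (a - b) * t
  merge = solve-∀

signedSurjSum-cong : ∀ B n {c d : ℕ → ℤ} → (∀ k → c k ≡ d k) → signedSurjSum B n c ≡ signedSurjSum B n d
signedSurjSum-cong B n c≗d = sumTo-cong B (λ k _ → cong (λ x → sgn (n ℕ.+ k) * x * + surjCount n k) (c≗d k))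

pos-*-+ : ∀ a b c d → + a * + b + + c * + d ≡ + (a ℕ.* b ℕ.+ c ℕ.* d)
pos-*-+ a b c d = trans (cong₂ _+_ (sym (ℤ.pos-* a b)) (sym (ℤ.pos-* c d))) (sym (ℤ.pos-+ (a ℕ.* b) (c ℕ.* d)))

C-weighted-difference : ∀ i j →
  + suc i * + (suc i C j) - + i * + (i C j) ≡ + suc j * + (i C j) + + j * + (i C pred j)
C-weighted-difference i j = begin
  + suc i * + (suc i C j) - + i * + (i C j)
    ≡⟨ cong₂ _-_ (ℤ.pos-* (suc i) _) (ℤ.pos-* i _) ⟨
  + (suc i ℕ.* (suc i C j)) - + (i ℕ.* (i C j))
    ≡⟨ cong (λ x → + x - + (i ℕ.* (i C j))) (C-weighted-step i j) ⟩
  + (i ℕ.* (i C j) ℕ.+ (suc j ℕ.* (i C j) ℕ.+ j ℕ.* (i C pred j))) - + (i ℕ.* (i C j))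
    ≡⟨ cong (_- + (i ℕ.* (i C j))) (ℤ.pos-+ (i ℕ.* (i C j)) _) ⟩
  + (i ℕ.* (i C j)) + + (suc j ℕ.* (i C j) ℕ.+ j ℕ.* (i C pred j)) - + (i ℕ.* (i C j))
    ≡⟨ cancel (+ (i ℕ.* (i C j))) (+ (suc j ℕ.* (i C j) ℕ.+ j ℕ.* (i C pred j))) ⟩
  + (suc j ℕ.* (i C j) ℕ.+ j ℕ.* (i C pred j))
    ≡⟨ pos-*-+ (suc j) (i C j) j (i C pred j) ⟨
  + suc j * + (i C j) + + j * + (i C pred j) ∎
  where
  cancel : ∀ a b → a + b - a ≡ b
  cancel = solve-∀

-- Coefficientwise form of x F(−1−x) = (−1)^n (1+x) F(x) for F(x) = Σ_k S(n,k) k! x^k.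
fubini-reciprocity : ∀ {B n} → n ≤ B → ∀ j →
  signedSurjSum B n (λ k → + (k C j)) ≡ + (surjCount n j ℕ.+ surjCount n (suc j))
fubini-reciprocity {B} {zero} _ j = trans (sumTo-vanishing-tail B _ vanish) (head-term j)
  where
  vanish : ∀ k → sgn (suc k) * + (suc k C j) * + 0 ≡ + 0
  vanish k = ℤ.*-zeroʳ (sgn (suc k) * + (suc k C j))
  head-term : ∀ j → + 1 * + (0 C j) * + 1 ≡ + (surjCount 0 j ℕ.+ surjCount 0 (suc j))
  head-term zero    = refl
  head-term (suc j) = refl
fubini-reciprocity {B} {suc n} n<B j = begin
  signedSurjSum B (suc n) (λ k → + (k C j))
    ≡⟨ signedSurjSum-suc n<B _ ⟩
  signedSurjSum B n (λ i → + suc i * + (suc i C j) - + i * + (i C j))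
    ≡⟨ signedSurjSum-cong B n (λ i → C-weighted-difference i j) ⟩
  signedSurjSum B n (λ i → + suc j * + (i C j) + + j * + (i C pred j))
    ≡⟨ signedSurjSum-linear B n (+ suc j) (+ j) _ _ ⟩
  + suc j * signedSurjSum B n (λ k → + (k C j)) + + j * signedSurjSum B n (λ k → + (k C pred j))
    ≡⟨ cong₂ _+_ (cong (+ suc j *_) (fubini-reciprocity n≤B j)) (lower-term j) ⟩
  + suc j * + (T n j ℕ.+ T n (suc j)) + + j * + (T n (pred j) ℕ.+ T n j)
    ≡⟨ pos-*-+ (suc j) _ j _ ⟩
  + (suc j ℕ.* (T n j ℕ.+ T n (suc j)) ℕ.+ j ℕ.* (T n (pred j) ℕ.+ T n j))
    ≡⟨ cong +_ (rearrange j (T n j) (T n (suc j)) (T n (pred j))) ⟩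
  + (j ℕ.* (T n j ℕ.+ T n (pred j)) ℕ.+ suc j ℕ.* (T n (suc j) ℕ.+ T n j))
    ≡⟨ cong₂ (λ x y → + (x ℕ.+ y)) (surjCount-suc n j) (surjCount-suc n (suc j)) ⟨
  + (T (suc n) j ℕ.+ T (suc n) (suc j)) ∎
  where
  T = surjCount
  n≤B = ℕ.<⇒≤ n<B
  lower-term : ∀ j → + j * signedSurjSum B n (λ k → + (k C pred j)) ≡ + j * + (T n (pred j) ℕ.+ T n j)
  lower-term zero    = trans (ℤ.*-zeroˡ (signedSurjSum B n (λ k → + (k C 0)))) (sym (ℤ.*-zeroˡ (+ (T n 0 ℕ.+ T n 0))))
  lower-term (suc j) = cong (+ suc j *_) (fubini-reciprocity n≤B j)
  rearrange : ∀ j a b p → suc j ℕ.* (a ℕ.+ b) ℕ.+ j ℕ.* (p ℕ.+ a) ≡ j ℕ.* (a ℕ.+ p) ℕ.+ suc j ℕ.* (b ℕ.+ a)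
  rearrange = ℕSolver.solve-∀

formula-term : ∀ {n k} → k ≤ n →
  sgn (n ℕ.∸ k) * + (S n k ℕ.* k ! ℕ.* 2 ^ k) ≡ sumTo n (λ j → sgn (n ℕ.+ k) * + (k C j) * + surjCount n k)
formula-term {n} {k} k≤n = begin
  sgn (n ℕ.∸ k) * + (surjCount n k ℕ.* 2 ^ k)
    ≡⟨ cong₂ _*_ (sgn-∸ k≤n) (ℤ.pos-* (surjCount n k) (2 ^ k)) ⟩
  σ * (t * + (2 ^ k))
    ≡⟨ reorder σ t (+ (2 ^ k)) ⟩
  σ * + (2 ^ k) * t
    ≡⟨ cong (λ x → σ * x * t) (C-row-sum n k≤n) ⟨
  σ * sumTo n (λ j → + (k C j)) * t
    ≡⟨ cong (_* t) (sumTo-distribˡ-* n σ _) ⟨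
  sumTo n (λ j → σ * + (k C j)) * t
    ≡⟨ sumTo-distribʳ-* n t _ ⟨
  sumTo n (λ j → σ * + (k C j) * t) ∎
  where
  σ = sgn (n ℕ.+ k)
  t = + surjCount n k
  reorder : ∀ σ t p → σ * (t * p) ≡ σ * p * t
  reorder = solve-∀

sumTo-surjCount-suc : ∀ m →
  sumTo (suc m) (λ j → + surjCount (suc m) (suc j)) ≡ sumTo (suc m) (λ j → + surjCount (suc m) j)
sumTo-surjCount-suc m = begin
  sumTo (suc m) (λ j → + T (suc j))
    ≡⟨ sumTo-vanishing-last m _ (cong +_ (surjCount-vanish (ℕ.n<1+n (suc m)))) ⟩
  sumTo m (λ j → + T (suc j))
    ≡⟨ ℤ.+-identityˡ _ ⟨
  + 0 + sumTo m (λ j → + T (suc j))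
    ≡⟨ sumTo-suc m _ ⟨
  sumTo (suc m) (λ j → + T j) ∎
  where
  T = surjCount (suc m)

formula≡sum-surjCount : ∀ m →
  formula (suc m) ≡ sumTo (suc m) (λ k → + surjCount (suc m) k + + surjCount (suc m) k)
formula≡sum-surjCount m = begin
  formula n
    ≡⟨ sumTo-cong n (λ k → formula-term) ⟩
  sumTo n (λ k → sumTo n (λ j → sgn (n ℕ.+ k) * + (k C j) * + T k))
    ≡⟨ sumTo-comm n n _ ⟩
  sumTo n (λ j → signedSurjSum n n (λ k → + (k C j)))
    ≡⟨ sumTo-cong n (λ j _ → trans (fubini-reciprocity {n} {n} ℕ.≤-refl j) (ℤ.pos-+ (T j) (T (suc j)))) ⟩
  sumTo n (λ j → + T j + + T (suc j))
    ≡⟨ sumTo-distrib-+ n _ _ ⟩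
  sumTo n (λ j → + T j) + sumTo n (λ j → + T (suc j))
    ≡⟨ cong (λ x → sumTo n (λ j → + T j) + x) (sumTo-surjCount-suc m) ⟩
  sumTo n (λ j → + T j) + sumTo n (λ j → + T j)
    ≡⟨ sumTo-distrib-+ n _ _ ⟨
  sumTo n (λ k → + T k + + T k) ∎
  where
  n = suc m
  T = surjCount n

-- Surjections

length-cartesianProductWith : ∀ {A B C : Set} (f : A → B → C) xs ys →
  length (cartesianProductWith f xs ys) ≡ length xs ℕ.* length ys
length-cartesianProductWith f []       ys = refl
length-cartesianProductWith f (x ∷ xs) ys = begin
  length (map (f x) ys ++ cartesianProductWith f xs ys)
    ≡⟨ List.length-++ (map (f x) ys) ⟩
  length (map (f x) ys) ℕ.+ length (cartesianProductWith f xs ys)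
    ≡⟨ cong₂ ℕ._+_ (List.length-map (f x) ys) (length-cartesianProductWith f xs ys) ⟩
  length ys ℕ.+ length xs ℕ.* length ys ∎

map⁺-restricted : ∀ {A B : Set} {P : A → Set} {f : A → B} →
  (∀ {x y} → P x → P y → f x ≡ f y → x ≡ y) → ∀ {xs} → All P xs → Unique xs → Unique (map f xs)
map⁺-restricted f-inj []         []          = []
map⁺-restricted f-inj (px ∷ pxs) (x∉xs ∷ u) =
  All.map⁺ (All.zipWith (λ (x≢y , py) fx≡fy → x≢y (f-inj px py fx≡fy)) (x∉xs , pxs))
  ∷ map⁺-restricted f-inj pxs u

IsSurjection : ∀ {n k} → Vec (Fin k) n → Set
IsSurjection {n} {k} v = ∀ (b : Fin k) → ∃ λ (i : Fin n) → lookup v i ≡ b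

prependAvoiding : ∀ {n k} → Fin (suc k) → Vec (Fin k) n → Vec (Fin (suc k)) (suc n)
prependAvoiding b g = b ∷ Vec.map (punchIn b) g

-- A surjection onto Fin (suc k) with first value b either takes the value b again, or
-- continues with a surjection onto the other k values.
surjections : (n k : ℕ) → List (Vec (Fin k) n)
surjections zero    zero    = [ [] ]
surjections zero    (suc k) = []
surjections (suc n) zero    = []
surjections (suc n) (suc k) =
  cartesianProductWith Vec._∷_ (allFin (suc k)) (surjections n (suc k)) ++
  cartesianProductWith prependAvoiding (allFin (suc k)) (surjections n k)

length-surjections : ∀ n k → length (surjections n k) ≡ surjCount n k
length-surjections zero    zero    = refl
length-surjections zero    (suc k) = refl
length-surjections (suc n) zero    = refl
length-surjections (suc n) (suc k) = begin
  length (hitting ++ avoiding)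
    ≡⟨ List.length-++ hitting ⟩
  length hitting ℕ.+ length avoiding
    ≡⟨ cong₂ ℕ._+_ (length-cartesianProductWith Vec._∷_ (allFin (suc k)) (surjections n (suc k)))
                   (length-cartesianProductWith prependAvoiding (allFin (suc k)) (surjections n k)) ⟩
  length (allFin (suc k)) ℕ.* length (surjections n (suc k)) ℕ.+ length (allFin (suc k)) ℕ.* length (surjections n k)
    ≡⟨ cong₂ (λ x y → length (allFin (suc k)) ℕ.* x ℕ.+ length (allFin (suc k)) ℕ.* y)
             (length-surjections n (suc k)) (length-surjections n k) ⟩
  length (allFin (suc k)) ℕ.* surjCount n (suc k) ℕ.+ length (allFin (suc k)) ℕ.* surjCount n k
    ≡⟨ cong (λ x → x ℕ.* surjCount n (suc k) ℕ.+ x ℕ.* surjCount n k) (List.length-tabulate {n = suc k} (λ i → i)) ⟩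
  suc k ℕ.* surjCount n (suc k) ℕ.+ suc k ℕ.* surjCount n k
    ≡⟨ ℕ.*-distribˡ-+ (suc k) (surjCount n (suc k)) (surjCount n k) ⟨
  suc k ℕ.* (surjCount n (suc k) ℕ.+ surjCount n k)
    ≡⟨ surjCount-suc n (suc k) ⟨
  surjCount (suc n) (suc k) ∎
  where
  hitting = cartesianProductWith Vec._∷_ (allFin (suc k)) (surjections n (suc k))
  avoiding = cartesianProductWith prependAvoiding (allFin (suc k)) (surjections n k)

lookup-prependAvoiding : ∀ {n k} b (g : Vec (Fin k) n) i →
  lookup (prependAvoiding b g) (suc i) ≡ punchIn b (lookup g i)
lookup-prependAvoiding b g i = Vec.lookup-map i (punchIn b) g

surjections-sound : ∀ n k {v : Vec (Fin k) n} → v ∈ surjections n k → IsSurjection v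
surjections-sound zero    zero    (here refl) ()
surjections-sound (suc n) (suc k) v∈
  with ∈-++⁻ (cartesianProductWith Vec._∷_ (allFin (suc k)) (surjections n (suc k))) v∈
... | inj₁ v∈hitting
  with b , g , _ , g∈ , refl ← ∈-cartesianProductWith⁻ Vec._∷_ (allFin (suc k)) _ v∈hitting = λ c →
  let i , gi≡c = surjections-sound n (suc k) g∈ c in suc i , gi≡c
... | inj₂ v∈avoiding
  with b , g , _ , g∈ , refl ← ∈-cartesianProductWith⁻ prependAvoiding (allFin (suc k)) _ v∈avoiding = onto
  where
  onto : IsSurjection (prependAvoiding b g)
  onto c with b Fin.≟ c
  ... | yes refl = zero , refl
  ... | no b≢c with i , gi≡c′ ← surjections-sound n k g∈ (punchOut b≢c) =
    suc i , trans (lookup-prependAvoiding b g i) (trans (cong (punchIn b) gi≡c′) (Fin.punchIn-punchOut b≢c))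

surjections-complete : ∀ n k (v : Vec (Fin k) n) → IsSurjection v → v ∈ surjections n k
surjections-complete zero    zero    []      _    = here refl
surjections-complete zero    (suc k) []      onto with () ← onto zero
surjections-complete (suc n) zero    (() ∷ _) _
surjections-complete (suc n) (suc k) (b ∷ g) onto with Fin.any? (λ i → lookup g i Fin.≟ b)
... | yes (i , gi≡b) = ∈-++⁺ˡ (∈-cartesianProductWith⁺ Vec._∷_ (∈-allFin b) (surjections-complete n (suc k) g g-onto))
  where
  g-onto : IsSurjection g
  g-onto c with b Fin.≟ c | onto c
  ... | yes refl | _             = i , gi≡b
  ... | no b≢c   | zero  , b≡c   = contradiction b≡c b≢c
  ... | no _     | suc j , gj≡c  = j , gj≡c
... | no b∉g = subst (_∈ surjections (suc n) (suc k)) (cong (b ∷_) (sym g≡map))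
  (∈-++⁺ʳ (cartesianProductWith Vec._∷_ (allFin (suc k)) (surjections n (suc k)))
    (∈-cartesianProductWith⁺ prependAvoiding (∈-allFin b) (surjections-complete n k g′ g′-onto)))
  where
  b≢g : ∀ i → b ≢ lookup g i
  b≢g i b≡gi = b∉g (i , sym b≡gi)
  g′ : Vec (Fin k) n
  g′ = tabulate (λ i → punchOut (b≢g i))
  lookup-g′ : ∀ i → punchIn b (lookup g′ i) ≡ lookup g i
  lookup-g′ i = trans (cong (punchIn b) (Vec.lookup∘tabulate _ i)) (Fin.punchIn-punchOut (b≢g i))
  g≡map : g ≡ Vec.map (punchIn b) g′
  g≡map = Pointwise-≡⇒≡ (ext (λ i → sym (trans (Vec.lookup-map i (punchIn b) g′) (lookup-g′ i))))
  g′-onto : IsSurjection g′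
  g′-onto c with onto (punchIn b c)
  ... | zero  , b≡c′ = contradiction (sym b≡c′) (Fin.punchInᵢ≢i b c)
  ... | suc j , gj≡c′ = j , Fin.punchIn-injective b _ _ (trans (lookup-g′ j) gj≡c′)

map-punchIn-injective : ∀ {n k} (b : Fin (suc k)) {g g′ : Vec (Fin k) n} →
  Vec.map (punchIn b) g ≡ Vec.map (punchIn b) g′ → g ≡ g′
map-punchIn-injective b {g} {g′} eq = Pointwise-≡⇒≡ (ext λ i → Fin.punchIn-injective b _ _ (begin
  punchIn b (lookup g i)        ≡⟨ Vec.lookup-map i (punchIn b) g ⟨
  lookup (Vec.map (punchIn b) g) i  ≡⟨ cong (λ w → lookup w i) eq ⟩
  lookup (Vec.map (punchIn b) g′) i ≡⟨ Vec.lookup-map i (punchIn b) g′ ⟩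
  punchIn b (lookup g′ i)       ∎))

prependAvoiding-injective : ∀ {n k} {b b′ : Fin (suc k)} {g g′ : Vec (Fin k) n} →
  prependAvoiding b g ≡ prependAvoiding b′ g′ → b ≡ b′ × g ≡ g′
prependAvoiding-injective {b = b} eq with refl ← Vec.∷-injectiveˡ eq =
  refl , map-punchIn-injective b (Vec.∷-injectiveʳ eq)

surjections-unique : ∀ n k → Unique (surjections n k)
surjections-unique zero    zero    = [] ∷ []
surjections-unique zero    (suc k) = []
surjections-unique (suc n) zero    = []
surjections-unique (suc n) (suc k) = Unique.++⁺
  (Unique.cartesianProductWith⁺ Vec._∷_ Vec.∷-injective (Unique.allFin⁺ (suc k)) (surjections-unique n (suc k)))
  (Unique.cartesianProductWith⁺ prependAvoiding prependAvoiding-injective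
    (Unique.allFin⁺ (suc k)) (surjections-unique n k))
  disjoint
  where
  disjoint : ∀ {v} → ¬ (v ∈ cartesianProductWith Vec._∷_ (allFin (suc k)) (surjections n (suc k))
                        × v ∈ cartesianProductWith prependAvoiding (allFin (suc k)) (surjections n k))
  disjoint (v∈hitting , v∈avoiding)
    with b , g , _ , g∈ , refl ← ∈-cartesianProductWith⁻ Vec._∷_ (allFin (suc k)) _ v∈hitting
       | b′ , g′ , _ , _ , eq ← ∈-cartesianProductWith⁻ prependAvoiding (allFin (suc k)) _ v∈avoiding
    with refl ← Vec.∷-injectiveˡ eq
    with i , gi≡b ← surjections-sound n (suc k) g∈ b =
      Fin.punchInᵢ≢i b (lookup g′ i) (begin
        punchIn b (lookup g′ i)           ≡⟨ Vec.lookup-map i (punchIn b) g′ ⟨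
        lookup (Vec.map (punchIn b) g′) i ≡⟨ cong (λ w → lookup w i) (Vec.∷-injectiveʳ eq) ⟨
        lookup g i                        ≡⟨ gi≡b ⟩
        b                                 ∎)

-- Levelled graphs are loop-threshold

alternate : Bool → ℕ → Bool
alternate t zero    = t
alternate t (suc m) = not (alternate t m)

levelAdj : ∀ {n} → Bool → (Fin n → ℕ) → Adj n
levelAdj t F i j = alternate t (F i ⊔ F j)

LoopThreshold-cong : ∀ {n} {A B : Adj n} → (∀ i j → A i j ≡ B i j) → LoopThreshold A → LoopThreshold B
LoopThreshold-cong A≗B (base A) = base _
LoopThreshold-cong A≗B (addIsolated A v isolated lt) =
  addIsolated _ v (λ u → trans (sym (A≗B v u)) (proj₁ (isolated u)) , trans (sym (A≗B u v)) (proj₂ (isolated u)))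
    (LoopThreshold-cong (λ i j → A≗B (punchIn v i) (punchIn v j)) lt)
LoopThreshold-cong A≗B (addDominating A v dominating lt) =
  addDominating _ v (λ u → trans (sym (A≗B v u)) (proj₁ (dominating u)) , trans (sym (A≗B u v)) (proj₂ (dominating u)))
    (LoopThreshold-cong (λ i j → A≗B (punchIn v i) (punchIn v j)) lt)

maximiser : ∀ {n} (F : Fin (suc n) → ℕ) → ∃ λ v → ∀ u → F u ≤ F v
maximiser F = argmax F zero (allFin _) , λ u → All.lookup (f[xs]≤f[argmax] {f = F} zero (allFin _)) (∈-allFin u)

top-level-row : ∀ {n} t (F : Fin n → ℕ) {v ty} → (∀ u → F u ≤ F v) → alternate t (F v) ≡ ty →
  ∀ u → (levelAdj t F v u ≡ ty) × (levelAdj t F u v ≡ ty)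
top-level-row t F F≤Fv Fv-type u =
  trans (cong (alternate t) (ℕ.m≥n⇒m⊔n≡m (F≤Fv u))) Fv-type , trans (cong (alternate t) (ℕ.m≤n⇒m⊔n≡n (F≤Fv u))) Fv-type

levelAdj-loopThreshold : ∀ n t (F : Fin (suc n) → ℕ) → LoopThreshold (levelAdj t F)
levelAdj-loopThreshold zero    t F = base _
levelAdj-loopThreshold (suc n) t F = peel (maximiser F)
  where
  peel : (∃ λ v → ∀ u → F u ≤ F v) → LoopThreshold (levelAdj t F)
  peel (top , F≤Ftop) with alternate t (F top) in top-type
  ... | true  = addDominating (levelAdj t F) top (top-level-row t F F≤Ftop top-type) below-top
    where below-top = levelAdj-loopThreshold n t (F ∘ punchIn top)
  ... | false = addIsolated (levelAdj t F) top (top-level-row t F F≤Ftop top-type) below-top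
    where below-top = levelAdj-loopThreshold n t (F ∘ punchIn top)

record Code (n : ℕ) : Set where
  constructor code
  field
    height : ℕ
    bottom : Bool
    levels : Vec (Fin height) n

ValidCode : ∀ {n} → Code n → Set
ValidCode c = IsSurjection (Code.levels c)

levelOf : ∀ {n} → Code n → Fin n → ℕ
levelOf c i = toℕ (lookup (Code.levels c) i)

codeGraph : ∀ {n} → Code n → Graph n
codeGraph c = tabulate (λ i → tabulate (levelAdj (Code.bottom c) (levelOf c) i))

adj-codeGraph : ∀ {n} (c : Code n) i j → adj (codeGraph c) i j ≡ levelAdj (Code.bottom c) (levelOf c) i j
adj-codeGraph c i j = trans (cong (λ row → lookup row j) (Vec.lookup∘tabulate _ i)) (Vec.lookup∘tabulate _ j)

codeGraph-loopThreshold : ∀ {m} (c : Code (suc m)) → IsLoopThresholdGraph (codeGraph c)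
codeGraph-loopThreshold {m} c = symmetric , LoopThreshold-cong (λ i j → sym (adj-codeGraph c i j))
                                              (levelAdj-loopThreshold m (Code.bottom c) (levelOf c))
  where
  symmetric : Symmetric (codeGraph c)
  symmetric i j = begin
    adj (codeGraph c) i j                                 ≡⟨ adj-codeGraph c i j ⟩
    alternate (Code.bottom c) (levelOf c i ⊔ levelOf c j) ≡⟨ cong (alternate (Code.bottom c)) (ℕ.⊔-comm (levelOf c i) _) ⟩
    alternate (Code.bottom c) (levelOf c j ⊔ levelOf c i) ≡⟨ adj-codeGraph c j i ⟨
    adj (codeGraph c) j i                                 ∎

-- Loop-threshold graphs are levelled

OntoBelow : ∀ {n} → ℕ → (Fin n → ℕ) → Set
OntoBelow {n} k F = (∀ i → F i < k) × (∀ b → b < k → ∃ λ (i : Fin n) → F i ≡ b)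

record Levelling {n} (A : Adj n) : Set where
  field
    height : ℕ
    bottom : Bool
    level  : Fin n → ℕ
    onto   : OntoBelow height level
    adj≡levelAdj : ∀ i j → A i j ≡ levelAdj bottom level i j

data PunchView {n} (v : Fin (suc n)) : Fin (suc n) → Set where
  pivot   : PunchView v v
  punched : ∀ i → PunchView v (punchIn v i)

punchView : ∀ {n} (v x : Fin (suc n)) → PunchView v x
punchView v x with v Fin.≟ x
... | yes refl = pivot
... | no v≢x   = subst (PunchView v) (Fin.punchIn-punchOut v≢x) (punched (punchOut v≢x))

levelling-insert : ∀ {n} {A : Adj (suc (suc n))} {v ty} → (∀ u → (A v u ≡ ty) × (A u v ≡ ty)) →
  (L : Levelling (delete v A)) → ∀ m → alternate (Levelling.bottom L) m ≡ ty →
  Levelling.height L ≤ suc m → m ≤ Levelling.height L → Levelling A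
levelling-insert {A = A} {v} {ty} row L m m-type k≤1+m m≤k = record
  { height = suc m ; bottom = t ; level = F′ ; onto = F′<1+m , F′-onto ; adj≡levelAdj = adj≡ }
  where
  open Levelling L using (onto; adj≡levelAdj) renaming (height to k; bottom to t; level to F)

  F′ : Fin (suc (suc _)) → ℕ
  F′ = insertAt F v m

  F′-punched : ∀ i → F′ (punchIn v i) ≡ F i
  F′-punched = insertAt-punchIn F v m

  F′≤F′v : ∀ x → F′ x ≤ F′ v
  F′≤F′v x with punchView v x
  ... | pivot     = ℕ.≤-refl
  ... | punched i = subst₂ _≤_ (sym (F′-punched i)) (sym (insertAt-lookup F v m))
                      (ℕ.≤-pred (ℕ.≤-trans (proj₁ onto i) k≤1+m))

  F′<1+m : ∀ x → F′ x < suc m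
  F′<1+m x = s≤s (subst (F′ x ≤_) (insertAt-lookup F v m) (F′≤F′v x))

  F′-onto : ∀ b → b < suc m → ∃ λ x → F′ x ≡ b
  F′-onto b b<1+m with b ℕ.≟ m
  ... | yes refl = v , insertAt-lookup F v m
  ... | no b≢m with i , Fi≡b ← proj₂ onto b (ℕ.<-≤-trans (ℕ.≤∧≢⇒< (ℕ.≤-pred b<1+m) b≢m) m≤k) =
    punchIn v i , trans (F′-punched i) Fi≡b

  new-row : ∀ u → (levelAdj t F′ v u ≡ ty) × (levelAdj t F′ u v ≡ ty)
  new-row = top-level-row t F′ F′≤F′v (trans (cong (alternate t) (insertAt-lookup F v m)) m-type)

  adj≡ : ∀ x y → A x y ≡ levelAdj t F′ x y
  adj≡ x y with punchView v x | punchView v y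
  ... | pivot     | _         = trans (proj₁ (row y)) (sym (proj₁ (new-row y)))
  ... | punched i | pivot     = trans (proj₂ (row (punchIn v i))) (sym (proj₂ (new-row (punchIn v i))))
  ... | punched i | punched j =
    trans (adj≡levelAdj i j) (sym (cong₂ (λ a b → alternate t (a ⊔ b)) (F′-punched i) (F′-punched j)))

height-positive : ∀ {n} {A : Adj (suc n)} (L : Levelling A) → 0 < Levelling.height L
height-positive L = ℕ.≤-<-trans z≤n (proj₁ (Levelling.onto L) zero)

levelling-extend : ∀ {n} {A : Adj (suc (suc n))} {v} ty → (∀ u → (A v u ≡ ty) × (A u v ≡ ty)) →
  Levelling (delete v A) → Levelling A
levelling-extend {A = A} ty row L = extend (alternate t (pred k) Bool.≟ ty)
  where
  open Levelling L using () renaming (height to k; bottom to t)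
  1+pred-k≡k : suc (pred k) ≡ k
  1+pred-k≡k = ℕ.suc-pred k {{ℕ.>-nonZero (height-positive L)}}
  extend : Dec (alternate t (pred k) ≡ ty) → Levelling A
  extend (yes top-type) = levelling-insert row L (pred k) top-type (ℕ.≤-reflexive (sym 1+pred-k≡k)) ℕ.pred[n]≤n
  extend (no ¬top-type) = levelling-insert row L k new-type (ℕ.n≤1+n k) ℕ.≤-refl
    where
    new-type : alternate t k ≡ ty
    new-type = trans (cong (alternate t) (sym 1+pred-k≡k)) (sym (¬-not (¬top-type ∘ sym)))

levelling : ∀ {n} {A : Adj n} → LoopThreshold A → Levelling A
levelling (base A) = record
  { height = 1 ; bottom = A zero zero ; level = λ _ → 0
  ; onto = (λ _ → s≤s z≤n) , (λ { zero _ → zero , refl ; (suc b) (s≤s ()) })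
  ; adj≡levelAdj = λ { zero zero → refl } }
levelling (addIsolated   A v isolated   lt) = levelling-extend false isolated   (levelling lt)
levelling (addDominating A v dominating lt) = levelling-extend true  dominating (levelling lt)

graph-ext : ∀ {n} {G H : Graph n} → (∀ i j → adj G i j ≡ adj H i j) → G ≡ H
graph-ext G≗H = Pointwise-≡⇒≡ (ext λ i → Pointwise-≡⇒≡ (ext (G≗H i)))

levelling-code : ∀ {n} {G : Graph n} → Levelling (adj G) →
  ∃ λ (c : Code n) → ValidCode c × G ≡ codeGraph c
levelling-code {n} {G} L = c , v-onto , graph-ext G≗c
  where
  open Levelling L renaming (height to k; bottom to t; level to F)
  v : Vec (Fin k) n
  v = tabulate (λ i → fromℕ< (proj₁ onto i))
  c = code k t v
  levelOf-c : ∀ i → levelOf c i ≡ F i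
  levelOf-c i = trans (cong toℕ (Vec.lookup∘tabulate _ i)) (Fin.toℕ-fromℕ< (proj₁ onto i))
  v-onto : IsSurjection v
  v-onto b with i , Fi≡b ← proj₂ onto (toℕ b) (Fin.toℕ<n b) = i , Fin.toℕ-injective (trans (levelOf-c i) Fi≡b)
  G≗c : ∀ i j → adj G i j ≡ adj (codeGraph c) i j
  G≗c i j = trans (adj≡levelAdj i j)
    (trans (cong₂ (λ a b → alternate t (a ⊔ b)) (sym (levelOf-c i)) (sym (levelOf-c j))) (sym (adj-codeGraph c i j)))

surjection-height : ∀ {n k} {v : Vec (Fin k) n} → IsSurjection v → k ≤ n
surjection-height {v = v} onto = Fin.injective⇒≤ {f = λ b → proj₁ (onto b)}
  (λ {b} {b′} eq → trans (sym (proj₂ (onto b))) (trans (cong (lookup v) eq) (proj₂ (onto b′))))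

-- A levelled graph determines its levels

alternate-suc : ∀ t m → alternate t (suc m) ≢ alternate t m
alternate-suc t m eq = not-¬ refl (sym eq)

alternate-injective : ∀ {t t′} m → alternate t m ≡ alternate t′ m → t ≡ t′
alternate-injective zero    eq = eq
alternate-injective (suc m) eq = alternate-injective m (not-injective eq)

Rise : ∀ {n} → Adj n → Fin n → Fin n → Set
Rise A i j = (A i i ≢ A j j) × (A i j ≡ A j j)

-- In a levelled graph Below A i j holds iff i lies on a lower level than j (LevelOrder).
Below : ∀ {n} → Adj n → Fin n → Fin n → Set
Below A i j = Rise A i j ⊎ ∃ λ z → Rise A i z × Rise A z j

module LevelOrder {n k} {A : Adj n} {t F} (onto : OntoBelow k F) (A≗ : ∀ i j → A i j ≡ levelAdj t F i j) where

  diagonal : ∀ i → A i i ≡ alternate t (F i)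
  diagonal i = trans (A≗ i i) (cong (alternate t) (ℕ.⊔-idem (F i)))

  upper : ∀ {i j} → F i ≤ F j → A i j ≡ A j j
  upper {i} {j} Fi≤Fj = trans (A≗ i j) (trans (cong (alternate t) (ℕ.m≤n⇒m⊔n≡n Fi≤Fj)) (sym (diagonal j)))

  lower : ∀ {i j} → F j ≤ F i → A i j ≡ A i i
  lower {i} {j} Fj≤Fi = trans (A≗ i j) (trans (cong (alternate t) (ℕ.m≥n⇒m⊔n≡m Fj≤Fi)) (sym (diagonal i)))

  rise⇒< : ∀ {i j} → Rise A i j → F i < F j
  rise⇒< {i} {j} (Aii≢Ajj , Aij≡Ajj) with F j ℕ.≤? F i
  ... | yes Fj≤Fi = contradiction (trans (sym (lower Fj≤Fi)) Aij≡Ajj) Aii≢Ajj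
  ... | no  Fj≰Fi = ℕ.≰⇒> Fj≰Fi

  <⇒rise : ∀ {i j} → F i < F j → alternate t (F i) ≢ alternate t (F j) → Rise A i j
  <⇒rise {i} {j} Fi<Fj types≢ =
    (λ eq → types≢ (trans (sym (diagonal i)) (trans eq (diagonal j)))) , upper (ℕ.<⇒≤ Fi<Fj)

  below⇒< : ∀ {i j} → Below A i j → F i < F j
  below⇒< (inj₁ rise)              = rise⇒< rise
  below⇒< (inj₂ (_ , rise₁ , rise₂)) = ℕ.<-trans (rise⇒< rise₁) (rise⇒< rise₂)

  same-type-below : ∀ {i j} → F i < F j → alternate t (F i) ≡ alternate t (F j) → Below A i j
  same-type-below {i} {j} Fi<Fj types≡ =
    inj₂ (z , <⇒rise Fi<Fz (λ eq → z-type (trans (sym types≡) eq)) , <⇒rise Fz<Fj (z-type ∘ sym))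
    where
    c = pred (F j)
    1+c≡Fj : suc c ≡ F j
    1+c≡Fj = ℕ.suc-pred (F j) {{ℕ.>-nonZero (ℕ.≤-<-trans z≤n Fi<Fj)}}
    c<Fj : c < F j
    c<Fj = ℕ.≤-reflexive 1+c≡Fj
    level-c = proj₂ onto c (ℕ.<-trans c<Fj (proj₁ onto j))
    z = proj₁ level-c
    Fz≡c : F z ≡ c
    Fz≡c = proj₂ level-c
    Fz<Fj : F z < F j
    Fz<Fj = subst (_< F j) (sym Fz≡c) c<Fj
    z-type : alternate t (F j) ≢ alternate t (F z)
    z-type eq = alternate-suc t c (trans (cong (alternate t) 1+c≡Fj) (trans eq (cong (alternate t) Fz≡c)))
    Fi<Fz : F i < F z
    Fi<Fz = subst (F i <_) (sym Fz≡c) (ℕ.≤∧≢⇒< (ℕ.≤-pred (subst (F i <_) (sym 1+c≡Fj) Fi<Fj))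
              (λ Fi≡c → z-type (trans (sym types≡) (cong (alternate t) (trans Fi≡c (sym Fz≡c))))))

  <⇒below : ∀ {i j} → F i < F j → Below A i j
  <⇒below {i} {j} Fi<Fj with alternate t (F i) Bool.≟ alternate t (F j)
  ... | no  types≢ = inj₁ (<⇒rise Fi<Fj types≢)
  ... | yes types≡ = same-type-below Fi<Fj types≡

order-embedding-inflationary : ∀ {n k} {F F′ : Fin n → ℕ} → OntoBelow k F →
  (∀ {i j} → F i < F j → F′ i < F′ j) → ∀ i → F i ≤ F′ i
order-embedding-inflationary {F = F} {F′} onto mono i = go (F i) i refl
  where
  go : ∀ m i → F i ≡ m → F i ≤ F′ i
  go zero    i Fi≡0   = subst (_≤ F′ i) (sym Fi≡0) z≤n
  go (suc b) i Fi≡1+b with z , Fz≡b ← proj₂ onto b (ℕ.<-trans (subst (b <_) (sym Fi≡1+b) (ℕ.n<1+n b)) (proj₁ onto i)) =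
    ℕ.≤-trans (ℕ.≤-reflexive (trans Fi≡1+b (cong suc (sym Fz≡b))))
              (ℕ.≤-trans (s≤s (go b z Fz≡b)) (mono (subst₂ _<_ (sym Fz≡b) (sym Fi≡1+b) (ℕ.n<1+n b))))

levels-unique : ∀ {n k k′} {A : Adj n} {t t′ F F′} → OntoBelow k F → OntoBelow k′ F′ →
  (∀ i j → A i j ≡ levelAdj t F i j) → (∀ i j → A i j ≡ levelAdj t′ F′ i j) → ∀ i → F i ≡ F′ i
levels-unique onto onto′ A≗ A≗′ i =
  ℕ.≤-antisym (order-embedding-inflationary onto  (O′.below⇒< ∘ O.<⇒below)  i)
              (order-embedding-inflationary onto′ (O.below⇒< ∘ O′.<⇒below) i)
  where
  module O  = LevelOrder onto  A≗
  module O′ = LevelOrder onto′ A≗′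

height-unique : ∀ {n k k′} {F F′ : Fin n → ℕ} → OntoBelow k F → OntoBelow k′ F′ → (∀ i → F i ≡ F′ i) → k ≡ k′
height-unique onto onto′ F≗F′ = ℕ.≤-antisym (bounded onto onto′ F≗F′) (bounded onto′ onto (sym ∘ F≗F′))
  where
  bounded : ∀ {n k k′} {F F′ : Fin n → ℕ} → OntoBelow k F → OntoBelow k′ F′ → (∀ i → F i ≡ F′ i) → k ≤ k′
  bounded onto onto′ F≗F′ = ℕ.≮⇒≥ λ k′<k →
    let i , Fi≡k′ = proj₂ onto _ k′<k in ℕ.<-irrefl (trans (sym (F≗F′ i)) Fi≡k′) (proj₁ onto′ i)

surjection-ontoBelow : ∀ {n k} {v : Vec (Fin k) n} → IsSurjection v → OntoBelow k (toℕ ∘ lookup v)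
surjection-ontoBelow {v = v} onto = (λ i → Fin.toℕ<n (lookup v i)) , λ b b<k →
  let i , vi≡b = onto (fromℕ< b<k) in i , trans (cong toℕ vi≡b) (Fin.toℕ-fromℕ< b<k)

code-≡ : ∀ {n k k′ t t′} {v : Vec (Fin k) n} {v′ : Vec (Fin k′) n} →
  k ≡ k′ → t ≡ t′ → (∀ i → toℕ (lookup v i) ≡ toℕ (lookup v′ i)) → code k t v ≡ code k′ t′ v′
code-≡ refl refl v≗v′ = cong (code _ _) (Pointwise-≡⇒≡ (ext (λ i → Fin.toℕ-injective (v≗v′ i))))

codeGraph-injective : ∀ {m} {c c′ : Code (suc m)} → ValidCode c → ValidCode c′ →
  codeGraph c ≡ codeGraph c′ → c ≡ c′
codeGraph-injective {c = c@(code k t v)} {c′@(code k′ t′ v′)} v-onto v′-onto G≡G′ =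
  code-≡ (height-unique onto onto′ levels≡) bottoms≡ levels≡
  where
  onto : OntoBelow k (levelOf c)
  onto = surjection-ontoBelow {v = v} v-onto
  onto′ : OntoBelow k′ (levelOf c′)
  onto′ = surjection-ontoBelow {v = v′} v′-onto
  A≗ : ∀ i j → adj (codeGraph c) i j ≡ levelAdj t (levelOf c) i j
  A≗ = adj-codeGraph c
  A≗′ : ∀ i j → adj (codeGraph c) i j ≡ levelAdj t′ (levelOf c′) i j
  A≗′ i j = trans (cong (λ G → adj G i j) G≡G′) (adj-codeGraph c′ i j)
  levels≡ : ∀ i → levelOf c i ≡ levelOf c′ i
  levels≡ = levels-unique onto onto′ A≗ A≗′
  bottoms≡ : t ≡ t′
  bottoms≡ = alternate-injective (levelOf c zero ⊔ levelOf c zero) (trans (sym (A≗ zero zero))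
    (trans (A≗′ zero zero) (cong (λ x → alternate t′ (x ⊔ x)) (sym (levels≡ zero)))))

-- Counting

codesOfHeight : ∀ n k → List (Code n)
codesOfHeight n k = map (code k true) (surjections n k) ++ map (code k false) (surjections n k)

codesUpTo : ∀ n → ℕ → List (Code n)
codesUpTo n zero    = codesOfHeight n zero
codesUpTo n (suc K) = codesUpTo n K ++ codesOfHeight n (suc K)

∈-codesOfHeight⁻ : ∀ {n k c} → c ∈ codesOfHeight n k → Code.height c ≡ k × ValidCode c
∈-codesOfHeight⁻ {n} {k} c∈ with ∈-++⁻ (map (code k true) (surjections n k)) c∈
... | inj₁ c∈true  with v , v∈ , refl ← ∈-map⁻ (code k true) c∈true  = refl , surjections-sound n k v∈
... | inj₂ c∈false with v , v∈ , refl ← ∈-map⁻ (code k false) c∈false = refl , surjections-sound n k v∈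

∈-codesOfHeight⁺ : ∀ {n} (c : Code n) → ValidCode c → c ∈ codesOfHeight n (Code.height c)
∈-codesOfHeight⁺ {n} (code k true  v) v-onto = ∈-++⁺ˡ (∈-map⁺ (code k true) (surjections-complete n k v v-onto))
∈-codesOfHeight⁺ {n} (code k false v) v-onto =
  ∈-++⁺ʳ (map (code k true) (surjections n k)) (∈-map⁺ (code k false) (surjections-complete n k v v-onto))

∈-codesUpTo⁻ : ∀ {n} K {c} → c ∈ codesUpTo n K → Code.height c ≤ K × ValidCode c
∈-codesUpTo⁻ zero c∈ = let height≡0 , valid = ∈-codesOfHeight⁻ c∈ in ℕ.≤-reflexive height≡0 , valid
∈-codesUpTo⁻ {n} (suc K) c∈ with ∈-++⁻ (codesUpTo n K) c∈
... | inj₁ c∈lower = let height≤K , valid = ∈-codesUpTo⁻ K c∈lower in ℕ.m≤n⇒m≤1+n height≤K , valid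
... | inj₂ c∈top   = let height≡1+K , valid = ∈-codesOfHeight⁻ c∈top in ℕ.≤-reflexive height≡1+K , valid

∈-codesUpTo⁺ : ∀ {n} K (c : Code n) → Code.height c ≤ K → ValidCode c → c ∈ codesUpTo n K
∈-codesUpTo⁺ zero    c z≤n    valid = ∈-codesOfHeight⁺ c valid
∈-codesUpTo⁺ {n} (suc K) c height≤1+K valid with ℕ.m≤n⇒m<n∨m≡n height≤1+K
... | inj₁ height<1+K = ∈-++⁺ˡ (∈-codesUpTo⁺ K c (ℕ.≤-pred height<1+K) valid)
... | inj₂ refl       = ∈-++⁺ʳ (codesUpTo n K) (∈-codesOfHeight⁺ c valid)

codesOfHeight-unique : ∀ n k → Unique (codesOfHeight n k)
codesOfHeight-unique n k = Unique.++⁺ (Unique.map⁺ code-injective (surjections-unique n k))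
                                      (Unique.map⁺ code-injective (surjections-unique n k)) bottoms-differ
  where
  code-injective : ∀ {t} {v v′ : Vec (Fin k) n} → code k t v ≡ code k t v′ → v ≡ v′
  code-injective refl = refl
  bottoms-differ : ∀ {c} → ¬ (c ∈ map (code k true) (surjections n k) × c ∈ map (code k false) (surjections n k))
  bottoms-differ (c∈true , c∈false) with _ , _ , refl ← ∈-map⁻ (code k true) c∈true
                                      with _ , _ , () ← ∈-map⁻ (code k false) c∈false

codesUpTo-unique : ∀ n K → Unique (codesUpTo n K)
codesUpTo-unique n zero    = codesOfHeight-unique n zero
codesUpTo-unique n (suc K) = Unique.++⁺ (codesUpTo-unique n K) (codesOfHeight-unique n (suc K)) heights-differ
  where
  heights-differ : ∀ {c} → ¬ (c ∈ codesUpTo n K × c ∈ codesOfHeight n (suc K))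
  heights-differ (c∈lower , c∈top) =
    ℕ.<-irrefl (proj₁ (∈-codesOfHeight⁻ c∈top)) (s≤s (proj₁ (∈-codesUpTo⁻ K c∈lower)))

length-codesOfHeight : ∀ n k → + length (codesOfHeight n k) ≡ + surjCount n k + + surjCount n k
length-codesOfHeight n k = begin
  + length (map (code k true) vs ++ map (code k false) vs)
    ≡⟨ cong +_ (List.length-++ (map (code k true) vs)) ⟩
  + (length (map (code k true) vs) ℕ.+ length (map (code k false) vs))
    ≡⟨ cong₂ (λ a b → + (a ℕ.+ b)) (List.length-map (code k true) vs) (List.length-map (code k false) vs) ⟩
  + (length vs ℕ.+ length vs)
    ≡⟨ cong (λ a → + (a ℕ.+ a)) (length-surjections n k) ⟩
  + (surjCount n k ℕ.+ surjCount n k)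
    ≡⟨ ℤ.pos-+ (surjCount n k) (surjCount n k) ⟩
  + surjCount n k + + surjCount n k ∎
  where
  vs = surjections n k

length-codesUpTo : ∀ n K → + length (codesUpTo n K) ≡ sumTo K (λ k → + surjCount n k + + surjCount n k)
length-codesUpTo n zero    = length-codesOfHeight n zero
length-codesUpTo n (suc K) = begin
  + length (codesUpTo n K ++ codesOfHeight n (suc K))
    ≡⟨ cong +_ (List.length-++ (codesUpTo n K)) ⟩
  + (length (codesUpTo n K) ℕ.+ length (codesOfHeight n (suc K)))
    ≡⟨ ℤ.pos-+ (length (codesUpTo n K)) _ ⟩
  + length (codesUpTo n K) + + length (codesOfHeight n (suc K))
    ≡⟨ cong₂ _+_ (length-codesUpTo n K) (length-codesOfHeight n (suc K)) ⟩
  sumTo (suc K) (λ k → + surjCount n k + + surjCount n k) ∎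

loopThresholdGraphs : ∀ n → List (Graph n)
loopThresholdGraphs n = map codeGraph (codesUpTo n n)

mainTheorem7 : (n : ℕ) → n ≥ 1 →
    ∃ λ gs → Unique gs × (∀ (G : Graph n) → (G ∈ gs) ⇔ IsLoopThresholdGraph G)
      × (+ length gs ≡ formula n)
mainTheorem7 n@(suc m) _ = loopThresholdGraphs n , unique , (λ G → mk⇔ sound complete) , count
  where
  unique : Unique (loopThresholdGraphs n)
  unique = map⁺-restricted codeGraph-injective
             (All.tabulate (λ c∈ → proj₂ (∈-codesUpTo⁻ n c∈))) (codesUpTo-unique n n)
  sound : ∀ {G} → G ∈ loopThresholdGraphs n → IsLoopThresholdGraph G
  sound G∈ with c , _ , refl ← ∈-map⁻ codeGraph G∈ = codeGraph-loopThreshold c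
  complete : ∀ {G} → IsLoopThresholdGraph G → G ∈ loopThresholdGraphs n
  complete {G} (_ , lt) with c , valid , refl ← levelling-code {G = G} (levelling lt) =
    ∈-map⁺ codeGraph (∈-codesUpTo⁺ n c (surjection-height {v = Code.levels c} valid) valid)
  count : + length (loopThresholdGraphs n) ≡ formula n
  count = trans (cong +_ (List.length-map codeGraph (codesUpTo n n)))
                (trans (length-codesUpTo n n) (sym (formula≡sum-surjCount m)))
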